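{- Let $s,t$ be positive integers, let $M$ be a matroid with the $(s,2s,t,2t)$-property, and let $(S_1,\dots,S_n)$ be an $s$-echidna of $M$ with $n\ge\max\{s+2t,2s+t\}-1$. Then: (i) for every $(s-1)$-element subset $I$ of $\{1,\dots,n\}$ and every $z\in E(M)-\bigcup_{i\in I}S_i$, there is a $2s$-element circuit of $M$ containing $\{z\}\cup\bigcup_{i\in I}S_i$; (ii) for every $(t-1)$-element subset $I$ of $\{1,\dots,n\}$ and every $z\in E(M)-\bigcup_{i\in I}S_i$, there is a $2t$-element cocircuit of $M$ containing $\{z\}\cup\bigcup_{i\in I}S_i$.
   Context: A matroid $M$ has the $(s,2s,t,2t)$-property if every $s$-element subset of $E(M)$ is contained in a $2s$-element circuit and every $t$-element subset of $E(M)$ is contained in a $2t$-element cocircuit. For a positive integer $k$, a $k$-echidna of order $n$ of $M$ is a partition $(S_1,\dots,S_n)$ of a subset of $E(M)$ such that $|S_i|=2$ for all $i$ and $\bigcup_{i\in I}S_i$ is a circuit of $M$ for every $k$-element $I\subseteq\{1,\dots,n\}$. -}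

module Defs where

open import Data.Nat using (ℕ; zero; suc; _*_)
open import Data.Bool using (true; false)
open import Data.Fin using (Fin)
import Data.Fin as F
open import Data.Fin.Subset using (Subset; _∈_; _∉_; _⊆_; _⊂_; _∪_; ∁; ⊥; ∣_∣; _-_; ⁅_⁆)
open import Data.Vec using (_∷_; [])
open import Data.Product using (Σ; ∃; _×_; _,_)
open import Relation.Nullary using (¬_)
open import Relation.Binary.PropositionalEquality using (_≡_)

record Matroid (m : ℕ) : Set₁ where
  field
    IsBase    : Subset m → Set
    baseExists : ∃ λ B → IsBase B
    exchange  : ∀ B₁ B₂ → IsBase B₁ → IsBase B₂ → ∀ x → x ∈ B₁ → x ∉ B₂ →
                ∃ λ y → y ∈ B₂ × y ∉ B₁ × IsBase ((B₁ - x) ∪ ⁅ y ⁆)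
open Matroid public

IndepWrt : ∀ {m} → (Subset m → Set) → Subset m → Set
IndepWrt {m} isBase I = ∃ λ (B : Subset m) → isBase B × I ⊆ B

CircuitWrt : ∀ {m} → (Subset m → Set) → Subset m → Set
CircuitWrt isBase C = ¬ IndepWrt isBase C × (∀ D → D ⊂ C → IndepWrt isBase D)

Independent : ∀ {m} → Matroid m → Subset m → Set
Independent M = IndepWrt (IsBase M)

Circuit : ∀ {m} → Matroid m → Subset m → Set
Circuit M = CircuitWrt (IsBase M)

DualBase : ∀ {m} → Matroid m → Subset m → Set
DualBase M B = IsBase M (∁ B)

Cocircuit : ∀ {m} → Matroid m → Subset m → Set
Cocircuit M = CircuitWrt (DualBase M)

unionOver : ∀ {n m} → (Fin n → Subset m) → Subset n → Subset m
unionOver {zero}  S []          = ⊥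
unionOver {suc n} S (true ∷ I)  = S F.zero ∪ unionOver (λ i → S (F.suc i)) I
unionOver {suc n} S (false ∷ I) = unionOver (λ i → S (F.suc i)) I

STProperty : ∀ {m} → Matroid m → ℕ → ℕ → Set
STProperty {m} M s t =
  (∀ (X : Subset m) → ∣ X ∣ ≡ s → ∃ λ C → Circuit M C × ∣ C ∣ ≡ 2 * s × X ⊆ C) ×
  (∀ (X : Subset m) → ∣ X ∣ ≡ t → ∃ λ C → Cocircuit M C × ∣ C ∣ ≡ 2 * t × X ⊆ C)

record Echidna {m} (M : Matroid m) (k n : ℕ) (S : Fin n → Subset m) : Set where
  field
    pairs    : ∀ i → ∣ S i ∣ ≡ 2
    disjoint : ∀ i j → ¬ i ≡ j → ∀ x → x ∈ S i → x ∉ S j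
    circuits : ∀ (I : Subset n) → ∣ I ∣ ≡ k → Circuit M (unionOver S I)

-- Circuits and cocircuits never meet in exactly one element. Hence a 2t-element
-- cocircuit D contains every pair S_j it meets: otherwise S_j together with s - 1
-- pairs avoiding D (there are enough of them, as n ≥ 2t + s - 1) is a circuit
-- meeting D in a single element. So a 2t-element cocircuit through one element of
-- each of t pairs contains all of them and, by counting, is their union; i.e. the
-- echidna is also a t-echidna of M*, and dually 2s-element circuits contain every
-- pair they meet. The circuit through z and one element of each S_i, i ∈ I, given
-- by the (s,2s,t,2t)-property thus contains ⋃_{i∈I} S_i; likewise for cocircuits.

module Submission where

open import Defs
open import Data.Nat using (ℕ; zero; suc; _+_; _*_; _∸_; _≤_; _<_; _⊔_; s≤s; z≤n)
open import Data.Nat.Properties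
  using ( ≤-trans; ≤-antisym; ≤-reflexive; module ≤-Reasoning; <⇒≱; +-mono-≤; +-monoˡ-≤
        ; +-suc; *-suc; *-zeroʳ; *-identityˡ; +-comm; m≤n+m; m≤m⊔n; m≤n⊔m
        ; +-∸-assoc; m+n∸m≡n; m+[n∸m]≡n; ∸-monoˡ-≤ )
open import Data.Bool using (true; false)
open import Data.Bool.Properties using (not-involutive)
open import Data.Fin using (Fin; zero; suc)
open import Data.Fin.Properties using (suc-injective; _≟_)
open import Data.Fin.Subset
  using (Subset; _∈_; _∉_; _⊆_; _∪_; _∩_; _─_; _-_; ∁; ∣_∣; ⁅_⁆; Nonempty)
import Data.Fin.Subset as Subset
open import Data.Fin.Subset.Properties
open import Data.Vec using (_∷_; []; tabulate; here; there)
open import Data.Vec.Properties using (lookup∘tabulate; []=⇒lookup; lookup⇒[]=)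
open import Data.List using (List; allFin) renaming (_∷_ to _∷ˡ_; [] to []ˡ)
import Data.List.Relation.Unary.Any as Any
open import Data.List.Membership.Propositional using () renaming (_∈_ to _∈ˡ_)
open import Data.List.Membership.Propositional.Properties using (∈-allFin)
open import Data.Product using (∃; _×_; _,_; proj₁; proj₂)
open import Data.Sum using (_⊎_; inj₁; inj₂)
import Data.Sum as Sum
open import Data.Empty using () renaming (⊥ to ⊥₀)
open import Function using (_∘_)
open import Relation.Nullary using (yes; no; does; contradiction)
open import Relation.Nullary.Decidable using (dec-true)
open import Relation.Unary using (Decidable)
open import Relation.Binary.PropositionalEquality
  using (_≡_; _≢_; refl; sym; trans; cong; cong₂; subst; module ≡-Reasoning)

Disjoint : ∀ {m} → Subset m → Subset m → Set
Disjoint p q = ∀ {x} → x ∈ p → x ∉ q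

PairwiseDisjoint : ∀ {n m} → (Fin n → Subset m) → Set
PairwiseDisjoint T = ∀ i j → i ≢ j → ∀ x → x ∈ T i → x ∉ T j

x∈p─q⇒x∉q : ∀ {n} (p q : Subset n) {x} → x ∈ p ─ q → x ∉ q
x∈p─q⇒x∉q (true ∷ p) (false ∷ q) here = λ ()
x∈p─q⇒x∉q (_ ∷ p) (_ ∷ q) (there x∈p─q) (there x∈q) = x∈p─q⇒x∉q p q x∈p─q x∈q

x∈p-y⇒x≢y : ∀ {n} {p : Subset n} {x y} → x ∈ p - y → x ≢ y
x∈p-y⇒x≢y {p = p} {y = y} h = x∉⁅y⁆⇒x≢y (x∈p─q⇒x∉q p ⁅ y ⁆ h)

p-x⊆q∧x∈q⇒p⊆q : ∀ {n} {p q : Subset n} {x} → p - x ⊆ q → x ∈ q → p ⊆ q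
p-x⊆q∧x∈q⇒p⊆q {x = x} p-x⊆q x∈q {y} y∈p with y ≟ x
... | yes refl = x∈q
... | no y≢x   = p-x⊆q (x∈p∧x≢y⇒x∈p-y y∈p y≢x)

∁-involutive : ∀ {n} (p : Subset n) → ∁ (∁ p) ≡ p
∁-involutive []      = refl
∁-involutive (b ∷ p) = cong₂ _∷_ (not-involutive b) (∁-involutive p)

∣p∪q∣≤∣p∣+∣q∣ : ∀ {n} (p q : Subset n) → ∣ p ∪ q ∣ ≤ ∣ p ∣ + ∣ q ∣
∣p∪q∣≤∣p∣+∣q∣ []          []          = z≤n
∣p∪q∣≤∣p∣+∣q∣ (true ∷ p)  (true ∷ q)  =
  s≤s (≤-trans (∣p∪q∣≤∣p∣+∣q∣ p q) (≤-trans (m≤n+m _ 1) (≤-reflexive (sym (+-suc ∣ p ∣ ∣ q ∣)))))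
∣p∪q∣≤∣p∣+∣q∣ (true ∷ p)  (false ∷ q) = s≤s (∣p∪q∣≤∣p∣+∣q∣ p q)
∣p∪q∣≤∣p∣+∣q∣ (false ∷ p) (true ∷ q)  =
  ≤-trans (s≤s (∣p∪q∣≤∣p∣+∣q∣ p q)) (≤-reflexive (sym (+-suc ∣ p ∣ ∣ q ∣)))
∣p∪q∣≤∣p∣+∣q∣ (false ∷ p) (false ∷ q) = ∣p∪q∣≤∣p∣+∣q∣ p q

∣p∪q∣≡∣p∣+∣q∣ : ∀ {n} {p q : Subset n} → Disjoint p q → ∣ p ∪ q ∣ ≡ ∣ p ∣ + ∣ q ∣
∣p∪q∣≡∣p∣+∣q∣ {p = []}        {[]}        _   = refl
∣p∪q∣≡∣p∣+∣q∣ {p = true ∷ p}  {true ∷ q}  p#q = contradiction here (p#q here)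
∣p∪q∣≡∣p∣+∣q∣ {p = true ∷ p}  {false ∷ q} p#q =
  cong suc (∣p∪q∣≡∣p∣+∣q∣ (λ x∈p → p#q (there x∈p) ∘ there))
∣p∪q∣≡∣p∣+∣q∣ {p = false ∷ p} {true ∷ q}  p#q =
  trans (cong suc (∣p∪q∣≡∣p∣+∣q∣ (λ x∈p → p#q (there x∈p) ∘ there))) (sym (+-suc ∣ p ∣ ∣ q ∣))
∣p∪q∣≡∣p∣+∣q∣ {p = false ∷ p} {false ∷ q} p#q = ∣p∪q∣≡∣p∣+∣q∣ (λ x∈p → p#q (there x∈p) ∘ there)

∣⁅x⁆∪p∣≡suc∣p∣ : ∀ {n} {x : Fin n} {p} → x ∉ p → ∣ ⁅ x ⁆ ∪ p ∣ ≡ suc ∣ p ∣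
∣⁅x⁆∪p∣≡suc∣p∣ {x = x} {p} x∉p =
  trans (∣p∪q∣≡∣p∣+∣q∣ (λ y∈⁅x⁆ y∈p → x∉p (subst (_∈ p) (x∈⁅y⁆⇒x≡y x y∈⁅x⁆) y∈p)))
        (cong (_+ ∣ p ∣) (∣⁅x⁆∣≡1 x))

x∈p⇒0<∣p∣ : ∀ {n} {p : Subset n} {x} → x ∈ p → 0 < ∣ p ∣
x∈p⇒0<∣p∣ {x = x} x∈p =
  subst (_≤ _) (∣⁅x⁆∣≡1 x) (p⊆q⇒∣p∣≤∣q∣ λ y∈⁅x⁆ → subst (_∈ _) (sym (x∈⁅y⁆⇒x≡y x y∈⁅x⁆)) x∈p)

0<∣p∣⇒Nonempty : ∀ {n} (p : Subset n) → 0 < ∣ p ∣ → Nonempty p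
0<∣p∣⇒Nonempty (true ∷ p)  _ = zero , here
0<∣p∣⇒Nonempty (false ∷ p) h with 0<∣p∣⇒Nonempty p h
... | x , x∈p = suc x , there x∈p

p⊆q∧∣q∣≤∣p∣⇒p≡q : ∀ {n} {p q : Subset n} → p ⊆ q → ∣ q ∣ ≤ ∣ p ∣ → p ≡ q
p⊆q∧∣q∣≤∣p∣⇒p≡q {p = p} {q} p⊆q ∣q∣≤∣p∣ = ⊆-antisym p⊆q q⊆p
  where
  q⊆p : q ⊆ p
  q⊆p {x} x∈q with x ∈? p
  ... | yes x∈p = x∈p
  ... | no  x∉p = contradiction ∣q∣≤∣p∣ (<⇒≱ (p⊂q⇒∣p∣<∣q∣ (p⊆q , x , x∈q , x∉p)))

∪-least : ∀ {n} {p q r : Subset n} → p ⊆ r → q ⊆ r → p ∪ q ⊆ r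
∪-least {p = p} {q} p⊆r q⊆r x∈p∪q = Sum.[ p⊆r , q⊆r ] (x∈p∪q⁻ p q x∈p∪q)

p∩q≡⁅x⁆ : ∀ {n} {p q : Subset n} {x} → x ∈ p → x ∈ q →
  (∀ {z} → z ∈ p → z ∈ q → z ≡ x) → p ∩ q ≡ ⁅ x ⁆
p∩q≡⁅x⁆ {p = p} {q} {x} x∈p x∈q only-x = ⊆-antisym
  (λ z∈p∩q → let z∈p , z∈q = x∈p∩q⁻ p q z∈p∩q in subst (_∈ ⁅ x ⁆) (sym (only-x z∈p z∈q)) (x∈⁅x⁆ x))
  (λ z∈⁅x⁆ → subst (_∈ p ∩ q) (sym (x∈⁅y⁆⇒x≡y x z∈⁅x⁆)) (x∈p∩q⁺ (x∈p , x∈q)))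

subset-of-size : ∀ {n} k (p : Subset n) → k ≤ ∣ p ∣ → ∃ λ q → q ⊆ p × ∣ q ∣ ≡ k
subset-of-size {n} zero    p           _       = Subset.⊥ , ⊥⊆ , ∣⊥∣≡0 n
subset-of-size     (suc k) (true ∷ p)  (s≤s h) with subset-of-size k p h
... | q , q⊆p , ∣q∣≡k = true ∷ q , in⊆in q⊆p , cong suc ∣q∣≡k
subset-of-size     (suc k) (false ∷ p) h       with subset-of-size (suc k) p h
... | q , q⊆p , ∣q∣≡k = false ∷ q , out⊆ q⊆p , ∣q∣≡k

∣p∣≡2⇒members : ∀ {n} {p : Subset n} {x y z} → ∣ p ∣ ≡ 2 →
  x ∈ p → y ∈ p → x ≢ y → z ∈ p → z ≡ x ⊎ z ≡ y
∣p∣≡2⇒members {p = p} {x} {y} {z} ∣p∣≡2 x∈p y∈p x≢y z∈p =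
  Sum.map (x∈⁅y⁆⇒x≡y x) (x∈⁅y⁆⇒x≡y y) (x∈p∪q⁻ ⁅ x ⁆ ⁅ y ⁆ (subst (z ∈_) (sym ⁅x,y⁆≡p) z∈p))
  where
  ⁅x,y⁆⊆p : ⁅ x ⁆ ∪ ⁅ y ⁆ ⊆ p
  ⁅x,y⁆⊆p w∈ with x∈p∪q⁻ ⁅ x ⁆ ⁅ y ⁆ w∈
  ... | inj₁ w∈⁅x⁆ = subst (_∈ p) (sym (x∈⁅y⁆⇒x≡y x w∈⁅x⁆)) x∈p
  ... | inj₂ w∈⁅y⁆ = subst (_∈ p) (sym (x∈⁅y⁆⇒x≡y y w∈⁅y⁆)) y∈p
  ∣⁅x,y⁆∣≡2 : ∣ ⁅ x ⁆ ∪ ⁅ y ⁆ ∣ ≡ 2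
  ∣⁅x,y⁆∣≡2 = trans (∣⁅x⁆∪p∣≡suc∣p∣ (x≢y ∘ x∈⁅y⁆⇒x≡y y)) (cong suc (∣⁅x⁆∣≡1 y))
  ⁅x,y⁆≡p : ⁅ x ⁆ ∪ ⁅ y ⁆ ≡ p
  ⁅x,y⁆≡p = p⊆q∧∣q∣≤∣p∣⇒p≡q ⁅x,y⁆⊆p (≤-reflexive (trans ∣p∣≡2 (sym ∣⁅x,y⁆∣≡2)))

select : ∀ {n} {P : Fin n → Set} → Decidable P → Subset n
select P? = tabulate (does ∘ P?)

∈-select⁺ : ∀ {n} {P : Fin n → Set} (P? : Decidable P) {i} → P i → i ∈ select P?
∈-select⁺ P? {i} Pi = lookup⇒[]= i _ (trans (lookup∘tabulate (does ∘ P?) i) (dec-true (P? i) Pi))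

∈-select⁻ : ∀ {n} {P : Fin n → Set} (P? : Decidable P) {i} → i ∈ select P? → P i
∈-select⁻ P? {i} i∈ with P? i | trans (sym (lookup∘tabulate (does ∘ P?) i)) ([]=⇒lookup i∈)
... | yes Pi | _  = Pi
... | no  _  | ()

PairwiseDisjoint-tail : ∀ {n m} {T : Fin (suc n) → Subset m} →
  PairwiseDisjoint T → PairwiseDisjoint (T ∘ suc)
PairwiseDisjoint-tail T-disj i j i≢j = T-disj (suc i) (suc j) (i≢j ∘ suc-injective)

x∈unionOver⁺ : ∀ {n m} (T : Fin n → Subset m) (I : Subset n) {i x} →
  i ∈ I → x ∈ T i → x ∈ unionOver T I
x∈unionOver⁺ T (true ∷ I)  here       x∈T = x∈p∪q⁺ (inj₁ x∈T)
x∈unionOver⁺ T (true ∷ I)  (there i∈) x∈T = x∈p∪q⁺ (inj₂ (x∈unionOver⁺ (T ∘ suc) I i∈ x∈T))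
x∈unionOver⁺ T (false ∷ I) (there i∈) x∈T = x∈unionOver⁺ (T ∘ suc) I i∈ x∈T

x∈unionOver⁻ : ∀ {n m} (T : Fin n → Subset m) (I : Subset n) {x} →
  x ∈ unionOver T I → ∃ λ i → i ∈ I × x ∈ T i
x∈unionOver⁻ {zero}  T []          x∈ = contradiction x∈ ∉⊥
x∈unionOver⁻ {suc n} T (true ∷ I)  x∈ with x∈p∪q⁻ (T zero) _ x∈
... | inj₁ x∈T₀ = zero , here , x∈T₀
... | inj₂ x∈⋃ with x∈unionOver⁻ (T ∘ suc) I x∈⋃
...   | i , i∈I , x∈Tᵢ = suc i , there i∈I , x∈Tᵢ
x∈unionOver⁻ {suc n} T (false ∷ I) x∈ with x∈unionOver⁻ (T ∘ suc) I x∈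
... | i , i∈I , x∈Tᵢ = suc i , there i∈I , x∈Tᵢ

unionOver-⊆ : ∀ {n m} {T U : Fin n → Subset m} (I : Subset n) →
  (∀ {i} → i ∈ I → T i ⊆ U i) → unionOver T I ⊆ unionOver U I
unionOver-⊆ {T = T} {U} I T⊆U x∈ with x∈unionOver⁻ T I x∈
... | i , i∈I , x∈Tᵢ = x∈unionOver⁺ U I i∈I (T⊆U i∈I x∈Tᵢ)

unionOver-least : ∀ {n m} {T : Fin n → Subset m} (I : Subset n) {X} →
  (∀ {i} → i ∈ I → T i ⊆ X) → unionOver T I ⊆ X
unionOver-least {T = T} I T⊆X x∈ with x∈unionOver⁻ T I x∈
... | i , i∈I , x∈Tᵢ = T⊆X i∈I x∈Tᵢ

∣unionOver∣≤ : ∀ {n m} (T : Fin n → Subset m) (I : Subset n) c →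
  (∀ i → ∣ T i ∣ ≤ c) → ∣ unionOver T I ∣ ≤ c * ∣ I ∣
∣unionOver∣≤ {m = m} T []          c _ = ≤-reflexive (trans (∣⊥∣≡0 m) (sym (*-zeroʳ c)))
∣unionOver∣≤         T (true ∷ I)  c ∣T∣≤c = begin
  ∣ T zero ∪ unionOver (T ∘ suc) I ∣       ≤⟨ ∣p∪q∣≤∣p∣+∣q∣ (T zero) _ ⟩
  ∣ T zero ∣ + ∣ unionOver (T ∘ suc) I ∣   ≤⟨ +-mono-≤ (∣T∣≤c zero) (∣unionOver∣≤ (T ∘ suc) I c (∣T∣≤c ∘ suc)) ⟩
  c + c * ∣ I ∣                            ≡⟨ sym (*-suc c ∣ I ∣) ⟩
  c * suc ∣ I ∣                            ∎
  where open ≤-Reasoning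
∣unionOver∣≤         T (false ∷ I) c ∣T∣≤c = ∣unionOver∣≤ (T ∘ suc) I c (∣T∣≤c ∘ suc)

∣unionOver∣≥ : ∀ {n m} (T : Fin n → Subset m) (I : Subset n) c → PairwiseDisjoint T →
  (∀ {i} → i ∈ I → c ≤ ∣ T i ∣) → c * ∣ I ∣ ≤ ∣ unionOver T I ∣
∣unionOver∣≥ {m = m} T []          c _      _ = ≤-reflexive (trans (*-zeroʳ c) (sym (∣⊥∣≡0 m)))
∣unionOver∣≥         T (true ∷ I)  c T-disj c≤∣T∣ = begin
  c * suc ∣ I ∣                            ≡⟨ *-suc c ∣ I ∣ ⟩
  c + c * ∣ I ∣                            ≤⟨ +-mono-≤ (c≤∣T∣ here) ∣⋃∣≥ ⟩
  ∣ T zero ∣ + ∣ unionOver (T ∘ suc) I ∣   ≡⟨ sym (∣p∪q∣≡∣p∣+∣q∣ T₀#⋃) ⟩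
  ∣ T zero ∪ unionOver (T ∘ suc) I ∣       ∎
  where
  open ≤-Reasoning
  ∣⋃∣≥ : c * ∣ I ∣ ≤ ∣ unionOver (T ∘ suc) I ∣
  ∣⋃∣≥ = ∣unionOver∣≥ (T ∘ suc) I c (PairwiseDisjoint-tail T-disj) (c≤∣T∣ ∘ there)
  T₀#⋃ : Disjoint (T zero) (unionOver (T ∘ suc) I)
  T₀#⋃ {x} x∈T₀ x∈⋃ with x∈unionOver⁻ (T ∘ suc) I x∈⋃
  ... | i , _ , x∈Tᵢ = T-disj zero (suc i) (λ ()) x x∈T₀ x∈Tᵢ
∣unionOver∣≥         T (false ∷ I) c T-disj c≤∣T∣ =
  ∣unionOver∣≥ (T ∘ suc) I c (PairwiseDisjoint-tail T-disj) (c≤∣T∣ ∘ there)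

∣unionOver∣≡ : ∀ {n m} (T : Fin n → Subset m) (I : Subset n) c → PairwiseDisjoint T →
  (∀ i → ∣ T i ∣ ≡ c) → ∣ unionOver T I ∣ ≡ c * ∣ I ∣
∣unionOver∣≡ T I c T-disj ∣T∣≡c = ≤-antisym
  (∣unionOver∣≤ T I c (≤-reflexive ∘ ∣T∣≡c))
  (∣unionOver∣≥ T I c T-disj (λ {i} _ → ≤-reflexive (sym (∣T∣≡c i))))

Orthogonal : ∀ {m} → (Subset m → Set) → (Subset m → Set) → Set
Orthogonal P Q = ∀ {X Y} e → P X → Q Y → X ∩ Y ≢ ⁅ e ⁆

module _ {m} (M : Matroid m) where

  exchange-into : ∀ {B B₀ x} → IsBase M B → IsBase M B₀ → x ∈ B → x ∉ B₀ →
    ∃ λ B′ → IsBase M B′ × B - x ⊆ B′ × B′ ⊆ (B - x) ∪ B₀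
  exchange-into {B} {B₀} {x} B-base B₀-base x∈B x∉B₀
    with exchange M B B₀ B-base B₀-base x x∈B x∉B₀
  ... | y , y∈B₀ , _ , B′-base = (B - x) ∪ ⁅ y ⁆ , B′-base , p⊆p∪q _ , B′⊆
    where
    B′⊆ : (B - x) ∪ ⁅ y ⁆ ⊆ (B - x) ∪ B₀
    B′⊆ w∈ with x∈p∪q⁻ (B - x) ⁅ y ⁆ w∈
    ... | inj₁ w∈B-x = x∈p∪q⁺ (inj₁ w∈B-x)
    ... | inj₂ w∈⁅y⁆ = x∈p∪q⁺ (inj₂ (subst (_∈ B₀) (sym (x∈⁅y⁆⇒x≡y y w∈⁅y⁆)) y∈B₀))

  -- Walk through the ground set, exchanging every element of A out of B
  -- for an element of B₀; the elements of K are never touched.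
  base-avoiding : ∀ {A K B₀} → IsBase M B₀ → Disjoint A B₀ → Independent M K → Disjoint K A →
    ∃ λ B → IsBase M B × K ⊆ B × Disjoint A B
  base-avoiding {A} {K} {B₀} B₀-base A#B₀ (B , B-base , K⊆B) K#A =
    go (allFin m) B B-base K⊆B (λ {x} _ _ → ∈-allFin x)
    where
    go : ∀ (L : List (Fin m)) B → IsBase M B → K ⊆ B → (∀ {x} → x ∈ A → x ∈ B → x ∈ˡ L) →
      ∃ λ B → IsBase M B × K ⊆ B × Disjoint A B
    go []ˡ      B B-base K⊆B A∩B⊆L =
      B , B-base , K⊆B , λ x∈A x∈B → contradiction (A∩B⊆L x∈A x∈B) λ ()
    go (x ∷ˡ L) B B-base K⊆B A∩B⊆L with x ∈? A | x ∈? B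
    ... | yes x∈A | yes x∈B with exchange-into B-base B₀-base x∈B (A#B₀ x∈A)
    ...   | B′ , B′-base , B-x⊆B′ , B′⊆ = go L B′ B′-base K⊆B′ A∩B′⊆L
      where
      K⊆B′ : K ⊆ B′
      K⊆B′ k∈K = B-x⊆B′ (x∈p∧x≢y⇒x∈p-y (K⊆B k∈K) λ { refl → K#A k∈K x∈A })
      A∩B′⊆L : ∀ {w} → w ∈ A → w ∈ B′ → w ∈ˡ L
      A∩B′⊆L w∈A w∈B′ with x∈p∪q⁻ (B - x) B₀ (B′⊆ w∈B′)
      ... | inj₁ w∈B-x = Any.tail (x∈p-y⇒x≢y w∈B-x) (A∩B⊆L w∈A (p─q⊆p B ⁅ x ⁆ w∈B-x))
      ... | inj₂ w∈B₀  = contradiction w∈B₀ (A#B₀ w∈A)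
    go (x ∷ˡ L) B B-base K⊆B A∩B⊆L | no x∉A | _ =
      go L B B-base K⊆B λ w∈A w∈B → Any.tail (λ { refl → x∉A w∈A }) (A∩B⊆L w∈A w∈B)
    go (x ∷ˡ L) B B-base K⊆B A∩B⊆L | yes _ | no x∉B =
      go L B B-base K⊆B λ w∈A w∈B → Any.tail (λ { refl → x∉B w∈B }) (A∩B⊆L w∈A w∈B)

  circuit-cocircuit-orthogonal : Orthogonal (Circuit M) (Cocircuit M)
  circuit-cocircuit-orthogonal {C} {D} e (C-dep , C-min) (D-dep , D-min) C∩D≡⁅e⁆ =
    contradict (D-min (D - e) (x∈p⇒p-x⊂p e∈D))
    where
    e∈C∩D : e ∈ C ∩ D
    e∈C∩D = subst (e ∈_) (sym C∩D≡⁅e⁆) (x∈⁅x⁆ e)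
    e∈C : e ∈ C
    e∈C = proj₁ (x∈p∩q⁻ C D e∈C∩D)
    e∈D : e ∈ D
    e∈D = proj₂ (x∈p∩q⁻ C D e∈C∩D)
    C-e#D-e : Disjoint (C - e) (D - e)
    C-e#D-e z∈C-e z∈D-e = x∈p-y⇒x≢y z∈C-e (x∈⁅y⁆⇒x≡y e (subst (_ ∈_) C∩D≡⁅e⁆
      (x∈p∩q⁺ (p─q⊆p C ⁅ e ⁆ z∈C-e , p─q⊆p D ⁅ e ⁆ z∈D-e))))
    contradict : IndepWrt (DualBase M) (D - e) → ⊥₀
    contradict (B₀′ , B₀-base , D-e⊆B₀′)
      with base-avoiding B₀-base (x∈p⇒x∉∁p ∘ D-e⊆B₀′) (C-min (C - e) (x∈p⇒p-x⊂p e∈C)) C-e#D-e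
    ... | B , B-base , C-e⊆B , D-e#B with e ∈? B
    ... | yes e∈B = C-dep (B , B-base , p-x⊆q∧x∈q⇒p⊆q C-e⊆B e∈B)
    ... | no  e∉B = D-dep (∁ B , subst (IsBase M) (sym (∁-involutive B)) B-base ,
                           p-x⊆q∧x∈q⇒p⊆q (x∉p⇒x∈∁p ∘ D-e#B) (x∉p⇒x∈∁p e∉B))

Orthogonal-sym : ∀ {m} {P Q : Subset m → Set} → Orthogonal P Q → Orthogonal Q P
Orthogonal-sym P⊥Q e QX PY X∩Y≡⁅e⁆ = P⊥Q e PY QX (trans (∩-comm _ _) X∩Y≡⁅e⁆)

Saturated : ∀ {n m} → (Fin n → Subset m) → Subset m → Set
Saturated S X = ∀ j {x y} → x ∈ S j → y ∈ S j → x ∈ X → y ∈ X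

module _ {m n} {S : Fin n → Subset m} (S-disjoint : PairwiseDisjoint S) where

  -- At most ∣ X ∣ of the disjoint blocks meet X.
  blocks-avoiding : ∀ X k → ∣ X ∣ + k ≤ n → ∃ λ K → ∣ K ∣ ≡ k × (∀ {i} → i ∈ K → Disjoint (S i) X)
  blocks-avoiding X k bound = avoiding (subset-of-size k (∁ touching) k≤∣∁touching∣)
    where
    meets? : Decidable (λ i → Nonempty (S i ∩ X))
    meets? i = nonempty? (S i ∩ X)
    touching : Subset n
    touching = select meets?
    ∩X-disjoint : PairwiseDisjoint (λ i → S i ∩ X)
    ∩X-disjoint i j i≢j x x∈Sᵢ∩X x∈Sⱼ∩X =
      S-disjoint i j i≢j x (p∩q⊆p (S i) X x∈Sᵢ∩X) (p∩q⊆p (S j) X x∈Sⱼ∩X)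
    ⋃⊆X : unionOver (λ i → S i ∩ X) touching ⊆ X
    ⋃⊆X = unionOver-least touching λ {i} _ → p∩q⊆q (S i) X
    ∣touching∣≤∣X∣ : ∣ touching ∣ ≤ ∣ X ∣
    ∣touching∣≤∣X∣ = begin
      ∣ touching ∣                             ≡⟨ sym (*-identityˡ _) ⟩
      1 * ∣ touching ∣                         ≤⟨ ∣unionOver∣≥ _ touching 1 ∩X-disjoint
                                                    (x∈p⇒0<∣p∣ ∘ proj₂ ∘ ∈-select⁻ meets?) ⟩
      ∣ unionOver (λ i → S i ∩ X) touching ∣   ≤⟨ p⊆q⇒∣p∣≤∣q∣ ⋃⊆X ⟩
      ∣ X ∣                                    ∎
      where open ≤-Reasoning
    k≤∣∁touching∣ : k ≤ ∣ ∁ touching ∣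
    k≤∣∁touching∣ = begin
      k                                ≡⟨ sym (m+n∸m≡n ∣ touching ∣ k) ⟩
      ∣ touching ∣ + k ∸ ∣ touching ∣  ≤⟨ ∸-monoˡ-≤ ∣ touching ∣ (≤-trans (+-monoˡ-≤ k ∣touching∣≤∣X∣) bound) ⟩
      n ∸ ∣ touching ∣                 ≡⟨ sym (∣∁p∣≡n∸∣p∣ touching) ⟩
      ∣ ∁ touching ∣                   ∎
      where open ≤-Reasoning
    avoiding : (∃ λ K → K ⊆ ∁ touching × ∣ K ∣ ≡ k) →
      ∃ λ K → ∣ K ∣ ≡ k × (∀ {i} → i ∈ K → Disjoint (S i) X)
    avoiding (K , K⊆∁touching , ∣K∣≡k) = K , ∣K∣≡k , λ i∈K x∈Sᵢ x∈X →
      x∈∁p⇒x∉p (K⊆∁touching i∈K) (∈-select⁺ meets? (_ , x∈p∩q⁺ (x∈Sᵢ , x∈X)))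

  -- If S j meets X in a single element x, then S j together with k - 1 blocks
  -- avoiding X is a Q-set meeting the P-set X exactly in x.
  orthogonal-saturated : (∀ i → ∣ S i ∣ ≡ 2) → ∀ {P Q k} → Orthogonal P Q → 1 ≤ k →
    (∀ I → ∣ I ∣ ≡ k → Q (unionOver S I)) → ∀ {X} → P X → ∣ X ∣ + k ∸ 1 ≤ n → Saturated S X
  orthogonal-saturated S-pairs {k = k} P⊥Q 1≤k Q-unions {X} PX bound j {x} {y} x∈Sⱼ y∈Sⱼ x∈X
    with y ∈? X
  ... | yes y∈X = y∈X
  ... | no  y∉X = refute (blocks-avoiding X (k ∸ 1) (subst (_≤ n) (+-∸-assoc ∣ X ∣ 1≤k) bound))
    where
    refute : (∃ λ K → ∣ K ∣ ≡ k ∸ 1 × (∀ {i} → i ∈ K → Disjoint (S i) X)) → y ∈ X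
    refute (K , ∣K∣≡k∸1 , K-avoids) =
      contradiction (p∩q≡⁅x⁆ x∈X (x∈unionOver⁺ S I (x∈p∪q⁺ (inj₁ (x∈⁅x⁆ j))) x∈Sⱼ) only-x)
                    (P⊥Q x PX (Q-unions I ∣I∣≡k))
      where
      I : Subset n
      I = ⁅ j ⁆ ∪ K
      ∣I∣≡k : ∣ I ∣ ≡ k
      ∣I∣≡k = trans (∣⁅x⁆∪p∣≡suc∣p∣ (λ j∈K → K-avoids j∈K x∈Sⱼ x∈X))
                    (trans (cong suc ∣K∣≡k∸1) (m+[n∸m]≡n 1≤k))
      only-x : ∀ {z} → z ∈ X → z ∈ unionOver S I → z ≡ x
      only-x z∈X z∈⋃ with x∈unionOver⁻ S I z∈⋃
      ... | i , i∈I , z∈Sᵢ with x∈p∪q⁻ ⁅ j ⁆ K i∈I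
      ...   | inj₂ i∈K   = contradiction z∈X (K-avoids i∈K z∈Sᵢ)
      ...   | inj₁ i∈⁅j⁆ with x∈⁅y⁆⇒x≡y j i∈⁅j⁆
      ...     | refl with ∣p∣≡2⇒members (S-pairs j) x∈Sⱼ y∈Sⱼ (λ { refl → y∉X x∈X }) z∈Sᵢ
      ...       | inj₁ z≡x  = z≡x
      ...       | inj₂ refl = contradiction z∈X y∉X

module _ {m n} {S : Fin n → Subset m}
  (S-disjoint : PairwiseDisjoint S) (S-pairs : ∀ i → ∣ S i ∣ ≡ 2) where

  private
    S-nonempty : ∀ i → Nonempty (S i)
    S-nonempty i = 0<∣p∣⇒Nonempty (S i) (subst (0 <_) (sym (S-pairs i)) (s≤s z≤n))

  rep : Fin n → Fin m
  rep i = proj₁ (S-nonempty i)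

  rep∈S : ∀ i → rep i ∈ S i
  rep∈S i = proj₂ (S-nonempty i)

  reps : Subset n → Subset m
  reps = unionOver (⁅_⁆ ∘ rep)

  reps⊆unionOver : ∀ I → reps I ⊆ unionOver S I
  reps⊆unionOver I = unionOver-⊆ I λ {i} _ x∈⁅repᵢ⁆ →
    subst (_∈ S i) (sym (x∈⁅y⁆⇒x≡y _ x∈⁅repᵢ⁆)) (rep∈S i)

  ∣reps∣≡∣I∣ : ∀ I → ∣ reps I ∣ ≡ ∣ I ∣
  ∣reps∣≡∣I∣ I = trans (∣unionOver∣≡ _ I 1 reps-disjoint (∣⁅x⁆∣≡1 ∘ rep)) (*-identityˡ ∣ I ∣)
    where
    reps-disjoint : PairwiseDisjoint (⁅_⁆ ∘ rep)
    reps-disjoint i j i≢j x x∈⁅repᵢ⁆ x∈⁅repⱼ⁆ = S-disjoint i j i≢j (rep i) (rep∈S i)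
      (subst (_∈ S j) (trans (sym (x∈⁅y⁆⇒x≡y _ x∈⁅repⱼ⁆)) (x∈⁅y⁆⇒x≡y _ x∈⁅repᵢ⁆)) (rep∈S j))

  saturated-⊇ : ∀ {X} → Saturated S X → ∀ I → reps I ⊆ X → unionOver S I ⊆ X
  saturated-⊇ X-saturated I reps⊆X = unionOver-least I λ {i} i∈I x∈Sᵢ →
    X-saturated i (rep∈S i) x∈Sᵢ (reps⊆X (x∈unionOver⁺ _ I i∈I (x∈⁅x⁆ (rep i))))

  -- Cover z and one representative from each block of I, then saturate.
  saturated-extension : ∀ {P : Subset m → Set} {k} → 1 ≤ k →
    (∀ X → ∣ X ∣ ≡ k → ∃ λ C → P C × ∣ C ∣ ≡ 2 * k × X ⊆ C) →
    (∀ {C} → P C → ∣ C ∣ ≡ 2 * k → Saturated S C) →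
    ∀ I → ∣ I ∣ ≡ k ∸ 1 → ∀ z → z ∉ unionOver S I →
    ∃ λ C → P C × ∣ C ∣ ≡ 2 * k × ⁅ z ⁆ ∪ unionOver S I ⊆ C
  saturated-extension {P} {k} 1≤k P-cover P-saturated I ∣I∣≡k∸1 z z∉⋃ =
    extend (P-cover (⁅ z ⁆ ∪ reps I) ∣⁅z⁆∪reps∣≡k)
    where
    ∣⁅z⁆∪reps∣≡k : ∣ ⁅ z ⁆ ∪ reps I ∣ ≡ k
    ∣⁅z⁆∪reps∣≡k = begin
      ∣ ⁅ z ⁆ ∪ reps I ∣  ≡⟨ ∣⁅x⁆∪p∣≡suc∣p∣ (z∉⋃ ∘ reps⊆unionOver I) ⟩
      suc ∣ reps I ∣      ≡⟨ cong suc (trans (∣reps∣≡∣I∣ I) ∣I∣≡k∸1) ⟩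
      suc (k ∸ 1)         ≡⟨ m+[n∸m]≡n 1≤k ⟩
      k                   ∎
      where open ≡-Reasoning
    extend : (∃ λ C → P C × ∣ C ∣ ≡ 2 * k × ⁅ z ⁆ ∪ reps I ⊆ C) →
      ∃ λ C → P C × ∣ C ∣ ≡ 2 * k × ⁅ z ⁆ ∪ unionOver S I ⊆ C
    extend (C , PC , ∣C∣≡2k , ⁅z⁆∪reps⊆C) = C , PC , ∣C∣≡2k ,
      ∪-least (⁅z⁆∪reps⊆C ∘ p⊆p∪q _)
              (saturated-⊇ (P-saturated PC ∣C∣≡2k) I (⁅z⁆∪reps⊆C ∘ q⊆p∪q _ _))

module EchidnaSaturation {m} (M : Matroid m) {s t n} {S : Fin n → Subset m}
  (1≤s : 1 ≤ s) (1≤t : 1 ≤ t) (st-property : STProperty M s t) (echidna : Echidna M s n S)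
  (cocircuit-bound : 2 * t + s ∸ 1 ≤ n) (circuit-bound : 2 * s + t ∸ 1 ≤ n) where

  open Echidna echidna

  cocircuits-saturated : ∀ {D} → Cocircuit M D → ∣ D ∣ ≡ 2 * t → Saturated S D
  cocircuits-saturated D-cocircuit ∣D∣≡2t =
    orthogonal-saturated disjoint pairs (Orthogonal-sym (circuit-cocircuit-orthogonal M)) 1≤s circuits
      D-cocircuit (subst (λ d → d + s ∸ 1 ≤ n) (sym ∣D∣≡2t) cocircuit-bound)

  unionOver-cocircuit : ∀ I → ∣ I ∣ ≡ t → Cocircuit M (unionOver S I)
  unionOver-cocircuit I ∣I∣≡t
    with proj₂ st-property (reps disjoint pairs I) (trans (∣reps∣≡∣I∣ disjoint pairs I) ∣I∣≡t)
  ... | D , D-cocircuit , ∣D∣≡2t , reps⊆D = subst (Cocircuit M) (sym ⋃≡D) D-cocircuit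
    where
    ∣D∣≤∣⋃∣ : ∣ D ∣ ≤ ∣ unionOver S I ∣
    ∣D∣≤∣⋃∣ = ≤-reflexive (begin
      ∣ D ∣                  ≡⟨ ∣D∣≡2t ⟩
      2 * t                  ≡⟨ cong (2 *_) (sym ∣I∣≡t) ⟩
      2 * ∣ I ∣              ≡⟨ sym (∣unionOver∣≡ S I 2 disjoint pairs) ⟩
      ∣ unionOver S I ∣      ∎)
      where open ≡-Reasoning
    ⋃≡D : unionOver S I ≡ D
    ⋃≡D = p⊆q∧∣q∣≤∣p∣⇒p≡q
      (saturated-⊇ disjoint pairs (cocircuits-saturated D-cocircuit ∣D∣≡2t) I reps⊆D) ∣D∣≤∣⋃∣

  circuits-saturated : ∀ {C} → Circuit M C → ∣ C ∣ ≡ 2 * s → Saturated S C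
  circuits-saturated C-circuit ∣C∣≡2s =
    orthogonal-saturated disjoint pairs (circuit-cocircuit-orthogonal M) 1≤t unionOver-cocircuit
      C-circuit (subst (λ c → c + t ∸ 1 ≤ n) (sym ∣C∣≡2s) circuit-bound)

lemma3p2 : ∀ {m} (M : Matroid m) (s t : ℕ) → 1 ≤ s → 1 ≤ t →
    STProperty M s t →
    ∀ (n : ℕ) (S : Fin n → Subset m) → Echidna M s n S →
    ((s + 2 * t) ⊔ (2 * s + t)) ∸ 1 ≤ n →
    (∀ (I : Subset n) → ∣ I ∣ ≡ s ∸ 1 → ∀ (z : Fin m) → z ∉ unionOver S I →
      ∃ λ C → Circuit M C × ∣ C ∣ ≡ 2 * s × (⁅ z ⁆ ∪ unionOver S I) ⊆ C) ×
    (∀ (I : Subset n) → ∣ I ∣ ≡ t ∸ 1 → ∀ (z : Fin m) → z ∉ unionOver S I →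
      ∃ λ C → Cocircuit M C × ∣ C ∣ ≡ 2 * t × (⁅ z ⁆ ∪ unionOver S I) ⊆ C)
lemma3p2 M s t 1≤s 1≤t st-property n S echidna bound =
    saturated-extension disjoint pairs 1≤s (proj₁ st-property) circuits-saturated
  , saturated-extension disjoint pairs 1≤t (proj₂ st-property) cocircuits-saturated
  where
  open Echidna echidna
  cocircuit-bound : 2 * t + s ∸ 1 ≤ n
  cocircuit-bound = ≤-trans (∸-monoˡ-≤ 1 (subst (_≤ (s + 2 * t) ⊔ (2 * s + t))
                                                  (+-comm s (2 * t)) (m≤m⊔n _ _))) bound
  circuit-bound : 2 * s + t ∸ 1 ≤ n
  circuit-bound = ≤-trans (∸-monoˡ-≤ 1 (m≤n⊔m (s + 2 * t) _)) bound
  open EchidnaSaturation M 1≤s 1≤t st-property echidna cocircuit-bound circuit-bound
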